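{- Let $G\subseteq GL_2(\mathbb{Z}/N_G\mathbb{Z})$ and $H\subseteq GL_2(\mathbb{Z}/N_H\mathbb{Z})$ be subgroups, $N=\operatorname{lcm}(N_G,N_H)$, $d=\gcd(N_G,N_H)$. Let $G_d=\{g\in G:g\equiv1\bmod d\}$, $H_d=\{h\in H:h\equiv1\bmod d\}$, $K_d=\lambda_d(G)\cap\lambda_d(H)$, and let $s_G:K_d\to G$, $s_H:K_d\to H$ be sections of reduction mod $d$. Let $A_G\subseteq GL_2(\mathbb{Z}/N\mathbb{Z})$ consist of, for each element $g$ of a generating set of $G_d$, one $a$ with $a\equiv g\bmod N_G$ and $a\equiv1\bmod N_H$; let $A_H$ consist of, for each element $h$ of a generating set of $H_d$, one $a$ with $a\equiv h\bmod N_H$ and $a\equiv1\bmod N_G$; and let $A_d$ consist of, for each element $z$ of a generating set of $K_d$, one $a_z$ with $a_z\equiv s_G(z)\bmod N_G$ and $a_z\equiv s_H(z)\bmod N_H$. Let $K=\langle A_G\cup A_H\cup A_d\rangle\subseteq GL_2(\mathbb{Z}/N\mathbb{Z})$. Then $\Gamma_K=\Gamma_G\cap\Gamma_H$.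
   Context: For $M\ge1$, $\lambda_M$ denotes reduction modulo $M$ (on $M_2(\mathbb{Z})$ or on $M_2(\mathbb{Z}/M'\mathbb{Z})$ for $M\mid M'$). For a subgroup $J\subseteq GL_2(\mathbb{Z}/M\mathbb{Z})$, $\Gamma_J=\{\gamma\in SL_2(\mathbb{Z}):\lambda_M(\gamma)\in J\cap SL_2(\mathbb{Z}/M\mathbb{Z})\}$. The lifts in $A_G,A_H,A_d$ exist by the Chinese Remainder Theorem. -}

module Defs where

open import Data.Nat as ℕ using (ℕ)
open import Data.Integer using (ℤ; +_; _+_; _*_; _-_)
open import Data.Integer.Divisibility using (_∣_)
open import Data.Product using (Σ; ∃; _×_; _,_)
open import Data.Sum using (_⊎_)
open import Relation.Binary.PropositionalEquality using (_≡_)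

record Mat : Set where
  constructor mat
  field
    a b c d : ℤ

open Mat public

infixl 7 _⊗_
_⊗_ : Mat → Mat → Mat
mat a₁ b₁ c₁ d₁ ⊗ mat a₂ b₂ c₂ d₂ =
  mat (a₁ * a₂ + b₁ * c₂) (a₁ * b₂ + b₁ * d₂)
      (c₁ * a₂ + d₁ * c₂) (c₁ * b₂ + d₁ * d₂)

I₂ : Mat
I₂ = mat (+ 1) (+ 0) (+ 0) (+ 1)

det : Mat → ℤ
det (mat a b c d) = a * d - b * c

_≡ℤ[_]_ : ℤ → ℕ → ℤ → Set
x ≡ℤ[ M ] y = (+ M) ∣ (x - y)

_≡[_]_ : Mat → ℕ → Mat → Set
x ≡[ M ] y =
  (a x ≡ℤ[ M ] a y) × (b x ≡ℤ[ M ] b y) × (c x ≡ℤ[ M ] c y) × (d x ≡ℤ[ M ] d y)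

-- A subset of M_2(ℤ/Mℤ) is represented by the predicate "λ_M x lies in it"
-- on integer matrices x (hence it is required to respect congruence mod M).
-- A subgroup of GL_2(ℤ/Mℤ):
record IsSubgroupGL₂ (M : ℕ) (J : Mat → Set) : Set where
  field
    resp   : ∀ {x y} → J x → x ≡[ M ] y → J y
    inGL   : ∀ {x} → J x → ∃ λ u → (det x * u) ≡ℤ[ M ] (+ 1)
    one    : J I₂
    mulCl  : ∀ {x y} → J x → J y → J (x ⊗ y)
    invCl  : ∀ {x} → J x → ∃ λ y → J y × (x ⊗ y) ≡[ M ] I₂

data Gen (M : ℕ) (S : Mat → Set) : Mat → Set where
  gen  : ∀ {s x} → S s → x ≡[ M ] s → Gen M S x
  unit : ∀ {x} → x ≡[ M ] I₂ → Gen M S x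
  mul  : ∀ {x y z} → Gen M S x → Gen M S y → z ≡[ M ] (x ⊗ y) → Gen M S z
  inv  : ∀ {x y} → Gen M S x → (x ⊗ y) ≡[ M ] I₂ → Gen M S y

record IsGeneratingSet (M : ℕ) (J S : Mat → Set) : Set where
  field
    sub  : ∀ {x} → S x → J x
    gens : ∀ {x} → J x → Gen M S x

kernelMod : ℕ → (Mat → Set) → Mat → Set
kernelMod d J x = J x × x ≡[ d ] I₂

image : ℕ → (Mat → Set) → Mat → Set
image d J z = ∃ λ g → J g × g ≡[ d ] z

interImage : ℕ → (Mat → Set) → (Mat → Set) → Mat → Set
interImage d G H z = image d G z × image d H z

-- s : K_d → J (J ⊆ GL_2(ℤ/M_J ℤ)) is a section of reduction mod d:
-- a well-defined map on classes mod d, landing in J, with λ_d ∘ s = id.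
record IsSection (d MJ : ℕ) (Kd J : Mat → Set) (s : Mat → Mat) : Set where
  field
    wd      : ∀ {z z'} → Kd z → z ≡[ d ] z' → s z ≡[ MJ ] s z'
    lands   : ∀ {z} → Kd z → J (s z)
    section : ∀ {z} → Kd z → s z ≡[ d ] z

record IsLiftSet (M₁ M₂ : ℕ) (S : Mat → Set) (f₁ f₂ : Mat → Mat)
                 (A : Mat → Set) : Set where
  field
    lift    : ∀ {g} → S g → ∃ λ x → A x × x ≡[ M₁ ] f₁ g × x ≡[ M₂ ] f₂ g
    onlyLift : ∀ {x} → A x → ∃ λ g → S g × x ≡[ M₁ ] f₁ g × x ≡[ M₂ ] f₂ g

constI : Mat → Mat
constI _ = I₂

idMat : Mat → Mat
idMat x = x

Γ : (Mat → Set) → Mat → Set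
Γ J γ = det γ ≡ + 1 × J γ

_∪₃_∪₃_ : (Mat → Set) → (Mat → Set) → (Mat → Set) → Mat → Set
(A ∪₃ B ∪₃ C) x = A x ⊎ B x ⊎ C x

{-# OPTIONS --safe #-}
-- By the Chinese remainder theorem a matrix is determined modulo N = lcm(N_G, N_H) by its
-- residues modulo N_G and N_H, so it suffices to realize every pair (g, h) ∈ G × H with
-- g ≡ h mod d as the two residues of a single element of K.  The lifts in A_d realize pairs
-- lying over the generators of K_d, and realized pairs are closed under products and inverses
-- (a matrix invertible modulo N_G and modulo N_H is invertible modulo N), so over every element
-- of K_d lies some realized pair.  The lifts in A_G and A_H realize (G_d, 1) and (1, H_d), which
-- moves a realized pair to any other pair over the same residue mod d.  Conversely every
-- generator of K reduces into G modulo N_G and into H modulo N_H.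
module Submission where

open import Defs
open import Data.Nat using (ℕ; NonZero)
open import Data.Nat.GCD using (gcd)
open import Data.Nat.LCM using (lcm)
open import Data.Product using (_×_)
open import Function.Bundles using (_⇔_)

import Data.Nat as ℕ
open import Data.Nat.Divisibility using (_∣_; ∣-trans; ∣-refl; ∣-reflexive; *-pres-∣; m∣m*n; n∣m*n)
open import Data.Nat.GCD using (gcd[m,n]∣m; gcd[m,n]∣n)
open import Data.Nat.LCM using (m∣lcm[m,n]; n∣lcm[m,n]; lcm-least; lcm-comm)
open import Data.Integer using (ℤ; +_; _+_; _*_; _-_; -_; ∣_∣)
open import Data.Integer.Properties using (∣-i∣≡∣i∣; abs-*)
import Data.Integer.Divisibility.Signed as Signed
open import Data.Integer.Tactic.RingSolver using (solve-∀)
open import Data.Product using (∃; ∃₂; _,_; proj₁; proj₂)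
open import Data.Sum using (inj₁; inj₂)
open import Function.Base using (_∘_)
open import Function.Bundles using (mk⇔)
open import Relation.Binary.PropositionalEquality using (_≡_; refl; sym; trans; cong; subst; module ≡-Reasoning)
open import Relation.Binary.Bundles using (Setoid)
import Relation.Binary.Reasoning.Setoid as SetoidReasoning

-- Wrapped in records (here and for matrices below) so that the modulus and both sides can be
-- inferred by unification; the bare relations of Defs compute away.
infix 4 _≈[_]_

record _≈[_]_ (x : ℤ) (M : ℕ) (y : ℤ) : Set where
  constructor ⟪_⟫
  field ≈⇒≡ℤ[] : x ≡ℤ[ M ] y

≈-intro : ∀ {M x y} q → x ≡ y + q * + M → x ≈[ M ] y
≈-intro {M} {y = y} q refl = ⟪ Signed.∣⇒∣ᵤ (Signed.divides q (y+z-y≡z y (q * + M))) ⟫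
  where
  y+z-y≡z : ∀ y z → y + z - y ≡ z
  y+z-y≡z = solve-∀

≈-elim : ∀ {M x y} → x ≈[ M ] y → ∃ λ q → x ≡ y + q * + M
≈-elim {x = x} {y} ⟪ M∣x-y ⟫ with Signed.∣ᵤ⇒∣ M∣x-y
... | Signed.divides q x-y≡qM = q , trans (x≡y+[x-y] x y) (cong (λ t → y + t) x-y≡qM)
  where
  x≡y+[x-y] : ∀ x y → x ≡ y + (x - y)
  x≡y+[x-y] = solve-∀

module _ {M : ℕ} where

  ≈-refl : ∀ {x} → x ≈[ M ] x
  ≈-refl {x} = ≈-intro (+ 0) (x≡x+0m x (+ M))
    where
    x≡x+0m : ∀ x m → x ≡ x + + 0 * m
    x≡x+0m = solve-∀

  ≈-reflexive : ∀ {x y} → x ≡ y → x ≈[ M ] y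
  ≈-reflexive refl = ≈-refl

  ≈-sym : ∀ {x y} → x ≈[ M ] y → y ≈[ M ] x
  ≈-sym {y = y} x≈y with ≈-elim x≈y
  ... | k , refl = ≈-intro (- k) (identity y k (+ M))
    where
    identity : ∀ y k m → y ≡ (y + k * m) + - k * m
    identity = solve-∀

  ≈-trans : ∀ {x y z} → x ≈[ M ] y → y ≈[ M ] z → x ≈[ M ] z
  ≈-trans {z = z} x≈y y≈z with ≈-elim x≈y | ≈-elim y≈z
  ... | k , refl | l , refl = ≈-intro (l + k) (identity z k l (+ M))
    where
    identity : ∀ z k l m → (z + l * m) + k * m ≡ z + (l + k) * m
    identity = solve-∀

  +-cong : ∀ {x y x′ y′} → x ≈[ M ] y → x′ ≈[ M ] y′ → x + x′ ≈[ M ] y + y′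
  +-cong {y = y} {y′ = y′} x≈y x′≈y′ with ≈-elim x≈y | ≈-elim x′≈y′
  ... | k , refl | l , refl = ≈-intro (k + l) (identity y y′ k l (+ M))
    where
    identity : ∀ y y′ k l m → (y + k * m) + (y′ + l * m) ≡ (y + y′) + (k + l) * m
    identity = solve-∀

  -‿cong : ∀ {x y} → x ≈[ M ] y → - x ≈[ M ] - y
  -‿cong {y = y} x≈y with ≈-elim x≈y
  ... | k , refl = ≈-intro (- k) (identity y k (+ M))
    where
    identity : ∀ y k m → - (y + k * m) ≡ - y + - k * m
    identity = solve-∀

  *-cong : ∀ {x y x′ y′} → x ≈[ M ] y → x′ ≈[ M ] y′ → x * x′ ≈[ M ] y * y′
  *-cong {y = y} {y′ = y′} x≈y x′≈y′ with ≈-elim x≈y | ≈-elim x′≈y′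
  ... | k , refl | l , refl = ≈-intro (k * y′ + y * l + k * l * + M) (identity y y′ k l (+ M))
    where
    identity : ∀ y y′ k l m → (y + k * m) * (y′ + l * m) ≡ y * y′ + (k * y′ + y * l + k * l * m) * m
    identity = solve-∀

≈-weaken : ∀ {M M′ x y} → M ∣ M′ → x ≈[ M′ ] y → x ≈[ M ] y
≈-weaken M∣M′ ⟪ M′∣x-y ⟫ = ⟪ ∣-trans M∣M′ M′∣x-y ⟫

≈-lcm : ∀ {M₁ M₂ x y} → x ≈[ M₁ ] y → x ≈[ M₂ ] y → x ≈[ lcm M₁ M₂ ] y
≈-lcm ⟪ M₁∣x-y ⟫ ⟪ M₂∣x-y ⟫ = ⟪ lcm-least M₁∣x-y M₂∣x-y ⟫

IsUnit : ℕ → ℤ → Set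
IsUnit M z = ∃ λ u → z * u ≈[ M ] + 1

a+b-ab≈1 : ∀ {M₁ M₂ a b} → a ≈[ M₁ ] + 1 → b ≈[ M₂ ] + 1 → a + b - a * b ≈[ M₁ ℕ.* M₂ ] + 1
a+b-ab≈1 {M₁} {M₂} {a} {b} ⟪ M₁∣a-1 ⟫ ⟪ M₂∣b-1 ⟫ =
  ⟪ subst (M₁ ℕ.* M₂ ∣_) (sym ∣a+b-ab-1∣≡∣a-1∣∣b-1∣) (*-pres-∣ M₁∣a-1 M₂∣b-1) ⟫
  where
  open ≡-Reasoning
  factor : ∀ a b → a + b - a * b - + 1 ≡ - ((a - + 1) * (b - + 1))
  factor = solve-∀
  ∣a+b-ab-1∣≡∣a-1∣∣b-1∣ : ∣ a + b - a * b - + 1 ∣ ≡ ∣ a - + 1 ∣ ℕ.* ∣ b - + 1 ∣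
  ∣a+b-ab-1∣≡∣a-1∣∣b-1∣ = begin
    ∣ a + b - a * b - + 1 ∣           ≡⟨ cong ∣_∣ (factor a b) ⟩
    ∣ - ((a - + 1) * (b - + 1)) ∣     ≡⟨ ∣-i∣≡∣i∣ ((a - + 1) * (b - + 1)) ⟩
    ∣ (a - + 1) * (b - + 1) ∣         ≡⟨ abs-* (a - + 1) (b - + 1) ⟩
    ∣ a - + 1 ∣ ℕ.* ∣ b - + 1 ∣       ∎

IsUnit-combine : ∀ {M₁ M₂ N z} → N ∣ M₁ ℕ.* M₂ → IsUnit M₁ z → IsUnit M₂ z → IsUnit N z
IsUnit-combine {z = z} N∣M₁M₂ (u₁ , zu₁≈1) (u₂ , zu₂≈1) =
  u₁ + u₂ - z * u₁ * u₂ ,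
  ≈-weaken N∣M₁M₂ (≈-trans (≈-reflexive (expand z u₁ u₂)) (a+b-ab≈1 zu₁≈1 zu₂≈1))
  where
  expand : ∀ z u₁ u₂ → z * (u₁ + u₂ - z * u₁ * u₂) ≡ z * u₁ + z * u₂ - z * u₁ * (z * u₂)
  expand = solve-∀

infix 4 _≋[_]_

record _≋[_]_ (x : Mat) (M : ℕ) (y : Mat) : Set where
  constructor ⟦_,_,_,_⟧
  field
    a-≈ : a x ≈[ M ] a y
    b-≈ : b x ≈[ M ] b y
    c-≈ : c x ≈[ M ] c y
    d-≈ : d x ≈[ M ] d y

≡[]⇒≋ : ∀ {M x y} → x ≡[ M ] y → x ≋[ M ] y
≡[]⇒≋ (a∣ , b∣ , c∣ , d∣) = ⟦ ⟪ a∣ ⟫ , ⟪ b∣ ⟫ , ⟪ c∣ ⟫ , ⟪ d∣ ⟫ ⟧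

≋⇒≡[] : ∀ {M x y} → x ≋[ M ] y → x ≡[ M ] y
≋⇒≡[] ⟦ ⟪ a∣ ⟫ , ⟪ b∣ ⟫ , ⟪ c∣ ⟫ , ⟪ d∣ ⟫ ⟧ = a∣ , b∣ , c∣ , d∣

module _ {M : ℕ} where

  ≋-refl : ∀ {x} → x ≋[ M ] x
  ≋-refl = ⟦ ≈-refl , ≈-refl , ≈-refl , ≈-refl ⟧

  ≋-reflexive : ∀ {x y} → x ≡ y → x ≋[ M ] y
  ≋-reflexive refl = ≋-refl

  ≋-sym : ∀ {x y} → x ≋[ M ] y → y ≋[ M ] x
  ≋-sym ⟦ p , q , r , s ⟧ = ⟦ ≈-sym p , ≈-sym q , ≈-sym r , ≈-sym s ⟧

  ≋-trans : ∀ {x y z} → x ≋[ M ] y → y ≋[ M ] z → x ≋[ M ] z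
  ≋-trans ⟦ p , q , r , s ⟧ ⟦ p′ , q′ , r′ , s′ ⟧ =
    ⟦ ≈-trans p p′ , ≈-trans q q′ , ≈-trans r r′ , ≈-trans s s′ ⟧

  ≋-setoid : Setoid _ _
  ≋-setoid = record
    { Carrier = Mat ; _≈_ = _≋[ M ]_
    ; isEquivalence = record { refl = ≋-refl ; sym = ≋-sym ; trans = ≋-trans } }

  ⊗-cong : ∀ {x x′ y y′} → x ≋[ M ] x′ → y ≋[ M ] y′ → x ⊗ y ≋[ M ] x′ ⊗ y′
  ⊗-cong ⟦ a₁ , b₁ , c₁ , d₁ ⟧ ⟦ a₂ , b₂ , c₂ , d₂ ⟧ =
    ⟦ +-cong (*-cong a₁ a₂) (*-cong b₁ c₂) , +-cong (*-cong a₁ b₂) (*-cong b₁ d₂) ,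
      +-cong (*-cong c₁ a₂) (*-cong d₁ c₂) , +-cong (*-cong c₁ b₂) (*-cong d₁ d₂) ⟧

  det-cong : ∀ {x y} → x ≋[ M ] y → det x ≈[ M ] det y
  det-cong ⟦ a≈ , b≈ , c≈ , d≈ ⟧ = +-cong (*-cong a≈ d≈) (-‿cong (*-cong b≈ c≈))

≋-weaken : ∀ {M M′ x y} → M ∣ M′ → x ≋[ M′ ] y → x ≋[ M ] y
≋-weaken M∣M′ ⟦ p , q , r , s ⟧ =
  ⟦ ≈-weaken M∣M′ p , ≈-weaken M∣M′ q , ≈-weaken M∣M′ r , ≈-weaken M∣M′ s ⟧

≋-lcm : ∀ {M₁ M₂ x y} → x ≋[ M₁ ] y → x ≋[ M₂ ] y → x ≋[ lcm M₁ M₂ ] y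
≋-lcm ⟦ p , q , r , s ⟧ ⟦ p′ , q′ , r′ , s′ ⟧ = ⟦ ≈-lcm p p′ , ≈-lcm q q′ , ≈-lcm r r′ , ≈-lcm s s′ ⟧

≡[]-refl : ∀ M x → x ≡[ M ] x
≡[]-refl M x = ≋⇒≡[] (≋-refl {M} {x})

mat-cong : ∀ {a b c d a′ b′ c′ d′} → a ≡ a′ → b ≡ b′ → c ≡ c′ → d ≡ d′ → mat a b c d ≡ mat a′ b′ c′ d′
mat-cong refl refl refl refl = refl

⊗-assoc : ∀ x y z → (x ⊗ y) ⊗ z ≡ x ⊗ (y ⊗ z)
⊗-assoc (mat a b c d) (mat e f g h) (mat i j k l) =
  mat-cong (entry a b e f g h i k) (entry a b e f g h j l) (entry c d e f g h i k) (entry c d e f g h j l)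
  where
  entry : ∀ p q e f g h r s → (p * e + q * g) * r + (p * f + q * h) * s ≡ p * (e * r + f * s) + q * (g * r + h * s)
  entry = solve-∀

⊗-identityˡ : ∀ x → I₂ ⊗ x ≡ x
⊗-identityˡ (mat a b c d) = mat-cong (first a c) (first b d) (second a c) (second b d)
  where
  first : ∀ p q → + 1 * p + + 0 * q ≡ p
  first = solve-∀
  second : ∀ p q → + 0 * p + + 1 * q ≡ q
  second = solve-∀

⊗-identityʳ : ∀ x → x ⊗ I₂ ≡ x
⊗-identityʳ (mat a b c d) = mat-cong (first a b) (second a b) (first c d) (second c d)
  where
  first : ∀ p q → p * + 1 + q * + 0 ≡ p
  first = solve-∀
  second : ∀ p q → p * + 0 + q * + 1 ≡ q
  second = solve-∀

det-⊗ : ∀ x y → det (x ⊗ y) ≡ det x * det y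
det-⊗ (mat a b c d) (mat e f g h) = multiplicative a b c d e f g h
  where
  multiplicative : ∀ a b c d e f g h →
    (a * e + b * g) * (c * f + d * h) - (a * f + b * h) * (c * e + d * g) ≡ (a * d - b * c) * (e * h - f * g)
  multiplicative = solve-∀

scaledAdjugate : ℤ → Mat → Mat
scaledAdjugate u (mat a b c d) = mat (u * d) (u * - b) (u * - c) (u * a)

scaledAdjugate-inverse : ∀ {M} x u → det x * u ≈[ M ] + 1 →
  x ⊗ scaledAdjugate u x ≋[ M ] I₂ × scaledAdjugate u x ⊗ x ≋[ M ] I₂
scaledAdjugate-inverse {M} (mat a b c d) u det·u≈1 =
  ⟦ diagonal (right-a a b c d u) , ≈-reflexive (right-b a b c d u) ,
    ≈-reflexive (right-c a b c d u) , diagonal (right-d a b c d u) ⟧ ,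
  ⟦ diagonal (left-a a b c d u) , ≈-reflexive (left-b a b c d u) ,
    ≈-reflexive (left-c a b c d u) , diagonal (left-d a b c d u) ⟧
  where
  diagonal : ∀ {t} → t ≡ (a * d - b * c) * u → t ≈[ M ] + 1
  diagonal t≡det·u = ≈-trans (≈-reflexive t≡det·u) det·u≈1
  right-a : ∀ a b c d u → a * (u * d) + b * (u * - c) ≡ (a * d - b * c) * u
  right-a = solve-∀
  right-b : ∀ a b c d u → a * (u * - b) + b * (u * a) ≡ + 0
  right-b = solve-∀
  right-c : ∀ a b c d u → c * (u * d) + d * (u * - c) ≡ + 0
  right-c = solve-∀
  right-d : ∀ a b c d u → c * (u * - b) + d * (u * a) ≡ (a * d - b * c) * u
  right-d = solve-∀
  left-a : ∀ a b c d u → (u * d) * a + (u * - b) * c ≡ (a * d - b * c) * u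
  left-a = solve-∀
  left-b : ∀ a b c d u → (u * d) * b + (u * - b) * d ≡ + 0
  left-b = solve-∀
  left-c : ∀ a b c d u → (u * - c) * a + (u * a) * c ≡ + 0
  left-c = solve-∀
  left-d : ∀ a b c d u → (u * - c) * b + (u * a) * d ≡ (a * d - b * c) * u
  left-d = solve-∀

module _ {M : ℕ} where
  open SetoidReasoning (≋-setoid {M})

  cancelˡ : ∀ {x x′} g → x ⊗ x′ ≋[ M ] I₂ → x ⊗ (x′ ⊗ g) ≋[ M ] g
  cancelˡ {x} {x′} g xx′≈1 = begin
    x ⊗ (x′ ⊗ g)   ≈⟨ ≋-reflexive (sym (⊗-assoc x x′ g)) ⟩
    (x ⊗ x′) ⊗ g   ≈⟨ ⊗-cong xx′≈1 (≋-refl {x = g}) ⟩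
    I₂ ⊗ g         ≈⟨ ≋-reflexive (⊗-identityˡ g) ⟩
    g              ∎

  inverseˡ≋inverseʳ : ∀ {l x y} → l ⊗ x ≋[ M ] I₂ → x ⊗ y ≋[ M ] I₂ → y ≋[ M ] l
  inverseˡ≋inverseʳ {l} {x} {y} lx≈1 xy≈1 = begin
    y              ≈⟨ ≋-reflexive (sym (⊗-identityˡ y)) ⟩
    I₂ ⊗ y         ≈⟨ ⊗-cong (≋-sym lx≈1) (≋-refl {x = y}) ⟩
    (l ⊗ x) ⊗ y    ≈⟨ ≋-reflexive (⊗-assoc l x y) ⟩
    l ⊗ (x ⊗ y)    ≈⟨ ⊗-cong (≋-refl {x = l}) xy≈1 ⟩
    l ⊗ I₂         ≈⟨ ≋-reflexive (⊗-identityʳ l) ⟩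
    l              ∎

  inverseʳ⇒det-unit : ∀ {x y} → x ⊗ y ≋[ M ] I₂ → IsUnit M (det x)
  inverseʳ⇒det-unit {x} {y} xy≈1 =
    det y , ≈-trans (≈-reflexive (sym (det-⊗ x y))) (det-cong {x = x ⊗ y} {I₂} xy≈1)

  inverseʳ⇒inverseˡ : ∀ {x y} → x ⊗ y ≋[ M ] I₂ → y ⊗ x ≋[ M ] I₂
  inverseʳ⇒inverseˡ {x} {y} xy≈1 = ≋-trans (⊗-cong y≈adj (≋-refl {x = x})) adj·x≈1
    where
    u : ℤ
    u = proj₁ (inverseʳ⇒det-unit {x} {y} xy≈1)
    adj·x≈1 : scaledAdjugate u x ⊗ x ≋[ M ] I₂
    adj·x≈1 = proj₂ (scaledAdjugate-inverse x u (proj₂ (inverseʳ⇒det-unit {x} {y} xy≈1)))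
    y≈adj : y ≋[ M ] scaledAdjugate u x
    y≈adj = inverseˡ≋inverseʳ {scaledAdjugate u x} {x} {y} adj·x≈1 xy≈1

  inverseʳ-unique : ∀ {x y y′} → x ⊗ y ≋[ M ] I₂ → x ⊗ y′ ≋[ M ] I₂ → y′ ≋[ M ] y
  inverseʳ-unique {x = x} {y} {y′} xy≈1 = inverseˡ≋inverseʳ {y} {x} {y′} (inverseʳ⇒inverseˡ {x} {y} xy≈1)

  inverseʳ-cong : ∀ {g x y g′} → g ≋[ M ] x → x ⊗ y ≋[ M ] I₂ → g ⊗ g′ ≋[ M ] I₂ → g′ ≋[ M ] y
  inverseʳ-cong {g} {x} {y} {g′} g≈x xy≈1 gg′≈1 =
    inverseʳ-unique {x = g} {y} {g′} (≋-trans (⊗-cong g≈x (≋-refl {x = y})) xy≈1) gg′≈1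

record IsGenClosed (M : ℕ) (S P : Mat → Set) : Set where
  field
    resp  : ∀ {x y} → P x → x ≋[ M ] y → P y
    base  : ∀ {s} → S s → P s
    one   : P I₂
    mulCl : ∀ {x y} → P x → P y → P (x ⊗ y)
    invCl : ∀ {x y} → P x → x ⊗ y ≋[ M ] I₂ → P y

module _ {M : ℕ} {S P : Mat → Set} (closed : IsGenClosed M S P) where
  open IsGenClosed closed

  Gen⊆ : ∀ {x} → Gen M S x → P x
  Gen⊆ (gen s∈S x≡s)      = resp (base s∈S) (≋-sym (≡[]⇒≋ x≡s))
  Gen⊆ (unit x≡1)         = resp one (≋-sym (≡[]⇒≋ x≡1))
  Gen⊆ (mul gx gy z≡xy)   = resp (mulCl (Gen⊆ gx) (Gen⊆ gy)) (≋-sym (≡[]⇒≋ z≡xy))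
  Gen⊆ (inv gx xy≡1)      = invCl (Gen⊆ gx) (≡[]⇒≋ xy≡1)

module _ {M : ℕ} {S : Mat → Set} where

  Gen-⊗ : ∀ {x y} → Gen M S x → Gen M S y → Gen M S (x ⊗ y)
  Gen-⊗ {x} {y} gx gy = mul gx gy (≡[]-refl M (x ⊗ y))

  Gen-resp : ∀ {x y} → Gen M S x → x ≋[ M ] y → Gen M S y
  Gen-resp {x} gx x≈y =
    mul gx (unit (≡[]-refl M I₂)) (≋⇒≡[] (≋-trans (≋-sym x≈y) (≋-reflexive (sym (⊗-identityʳ x)))))

  Gen-inverse : ∀ {x} → Gen M S x → IsUnit M (det x) → ∃ λ y → Gen M S y × x ⊗ y ≋[ M ] I₂
  Gen-inverse {x} gx (u , det·u≈1) = scaledAdjugate u x , inv gx (≋⇒≡[] x·adj≈1) , x·adj≈1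
    where
    x·adj≈1 : x ⊗ scaledAdjugate u x ≋[ M ] I₂
    x·adj≈1 = proj₁ (scaledAdjugate-inverse x u det·u≈1)

module Subgroup {M : ℕ} {J : Mat → Set} (J-subgroup : IsSubgroupGL₂ M J) where
  open IsSubgroupGL₂ J-subgroup

  resp≋ : ∀ {x y} → J x → x ≋[ M ] y → J y
  resp≋ x∈J x≈y = resp x∈J (≋⇒≡[] x≈y)

  inverse∈ : ∀ {x y} → J x → x ⊗ y ≋[ M ] I₂ → J y
  inverse∈ {x} {y} x∈J xy≈1 with invCl x∈J
  ... | y′ , y′∈J , xy′≡1 = resp≋ y′∈J (inverseʳ-unique {x = x} {y} {y′} xy≈1 (≡[]⇒≋ xy′≡1))

  Gen-closed : ∀ {M′ S} → M ∣ M′ → (∀ {s} → S s → J s) → IsGenClosed M′ S J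
  Gen-closed M∣M′ S⊆J = record
    { resp  = λ x∈J x≈y → resp≋ x∈J (≋-weaken M∣M′ x≈y)
    ; base  = S⊆J
    ; one   = one
    ; mulCl = mulCl
    ; invCl = λ x∈J xy≈1 → inverse∈ x∈J (≋-weaken M∣M′ xy≈1)
    }

-- Realizing a pair of residues by one matrix of a generated subgroup

Realizes : ℕ → ℕ → (Mat → Set) → Mat → Mat → Set
Realizes M₁ M₂ W g h = ∃ λ w → W w × w ≋[ M₁ ] g × w ≋[ M₂ ] h

Realizes-swap : ∀ {M₁ M₂ W g h} → Realizes M₁ M₂ W g h → Realizes M₂ M₁ W h g
Realizes-swap (w , w∈W , w≈g , w≈h) = w , w∈W , w≈h , w≈g

module Realization {M₁ M₂ N : ℕ} (M₁∣N : M₁ ∣ N) (M₂∣N : M₂ ∣ N) (N∣lcm : N ∣ lcm M₁ M₂)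
                   (A : Mat → Set) where

  realizes-resp : ∀ {g h g′ h′} → Realizes M₁ M₂ (Gen N A) g h →
    g ≋[ M₁ ] g′ → h ≋[ M₂ ] h′ → Realizes M₁ M₂ (Gen N A) g′ h′
  realizes-resp (w , w∈W , w≈g , w≈h) g≈g′ h≈h′ = w , w∈W , ≋-trans w≈g g≈g′ , ≋-trans w≈h h≈h′

  realizes-I₂ : Realizes M₁ M₂ (Gen N A) I₂ I₂
  realizes-I₂ = I₂ , unit (≡[]-refl N I₂) , ≋-refl , ≋-refl

  realizes-⊗ : ∀ {g h g′ h′} → Realizes M₁ M₂ (Gen N A) g h → Realizes M₁ M₂ (Gen N A) g′ h′ →
    Realizes M₁ M₂ (Gen N A) (g ⊗ g′) (h ⊗ h′)
  realizes-⊗ (w , w∈W , w≈g , w≈h) (w′ , w′∈W , w′≈g′ , w′≈h′) =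
    w ⊗ w′ , Gen-⊗ w∈W w′∈W , ⊗-cong w≈g w′≈g′ , ⊗-cong w≈h w′≈h′

  -- det w is a unit modulo M₁ and modulo M₂, hence modulo N, so w has an inverse in Gen N A.
  realizes-inverse : ∀ {g h g′ h′} → Realizes M₁ M₂ (Gen N A) g h →
    g ⊗ g′ ≋[ M₁ ] I₂ → h ⊗ h′ ≋[ M₂ ] I₂ → Realizes M₁ M₂ (Gen N A) g′ h′
  realizes-inverse {g′ = g′} {h′ = h′} (w , w∈W , w≈g , w≈h) gg′≈1 hh′≈1 =
    v , v∈W , inverseʳ-unique {x = w} {g′} {v} wg′≈1 (≋-weaken M₁∣N wv≈1) ,
              inverseʳ-unique {x = w} {h′} {v} wh′≈1 (≋-weaken M₂∣N wv≈1)
    where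
    wg′≈1 : w ⊗ g′ ≋[ M₁ ] I₂
    wg′≈1 = ≋-trans (⊗-cong w≈g (≋-refl {x = g′})) gg′≈1
    wh′≈1 : w ⊗ h′ ≋[ M₂ ] I₂
    wh′≈1 = ≋-trans (⊗-cong w≈h (≋-refl {x = h′})) hh′≈1
    N∣M₁M₂ : N ∣ M₁ ℕ.* M₂
    N∣M₁M₂ = ∣-trans N∣lcm (lcm-least {M₁} {M₂} (m∣m*n M₂) (n∣m*n M₁))
    inverse : ∃ λ v → Gen N A v × w ⊗ v ≋[ N ] I₂
    inverse = Gen-inverse w∈W (IsUnit-combine {M₁} {M₂} {N} {det w} N∣M₁M₂
                                 (inverseʳ⇒det-unit {x = w} wg′≈1) (inverseʳ⇒det-unit {x = w} wh′≈1))
    v : Mat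
    v = proj₁ inverse
    v∈W : Gen N A v
    v∈W = proj₁ (proj₂ inverse)
    wv≈1 : w ⊗ v ≋[ N ] I₂
    wv≈1 = proj₂ (proj₂ inverse)

  realizes-diagonal : ∀ {γ} → Realizes M₁ M₂ (Gen N A) γ γ → Gen N A γ
  realizes-diagonal (w , w∈W , w≈γ , w≈γ′) = Gen-resp w∈W (≋-weaken N∣lcm (≋-lcm w≈γ w≈γ′))

  realizes-kernel : ∀ {S} → (∀ {s} → S s → Realizes M₁ M₂ (Gen N A) s I₂) →
    ∀ {g} → Gen M₁ S g → Realizes M₁ M₂ (Gen N A) g I₂
  realizes-kernel lifts = Gen⊆ record
    { resp  = λ r g≈g′ → realizes-resp r g≈g′ ≋-refl
    ; base  = lifts
    ; one   = realizes-I₂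
    ; mulCl = λ r r′ → realizes-resp (realizes-⊗ r r′) ≋-refl (≋-reflexive (⊗-identityˡ I₂))
    ; invCl = λ r gg′≈1 → realizes-inverse r gg′≈1 (≋-reflexive (⊗-identityˡ I₂))
    }

IsLiftSet-swap : ∀ {M₁ M₂ S f₁ f₂ A} → IsLiftSet M₁ M₂ S f₁ f₂ A → IsLiftSet M₂ M₁ S f₂ f₁ A
IsLiftSet-swap lifts = record
  { lift     = λ s∈S → let (x , x∈A , x≡f₁s , x≡f₂s) = lift s∈S in x , x∈A , x≡f₂s , x≡f₁s
  ; onlyLift = λ x∈A → let (s , s∈S , x≡f₁s , x≡f₂s) = onlyLift x∈A in s , s∈S , x≡f₂s , x≡f₁s
  }
  where open IsLiftSet lifts

liftSet⊆ : ∀ {M₁ M₂ S f₁ f₂ A J} → IsSubgroupGL₂ M₁ J → IsLiftSet M₁ M₂ S f₁ f₂ A →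
  (∀ {s} → S s → J (f₁ s)) → ∀ {x} → A x → J x
liftSet⊆ J-subgroup lifts f₁S⊆J x∈A with IsLiftSet.onlyLift lifts x∈A
... | s , s∈S , x≡f₁s , _ = Subgroup.resp≋ J-subgroup (f₁S⊆J s∈S) (≋-sym (≡[]⇒≋ x≡f₁s))

lift-realizes : ∀ {M₁ M₂ N S f₁ f₂ A A′} → IsLiftSet M₁ M₂ S f₁ f₂ A → (∀ {x} → A x → A′ x) →
  ∀ {s} → S s → Realizes M₁ M₂ (Gen N A′) (f₁ s) (f₂ s)
lift-realizes {N = N} lifts A⊆A′ s∈S with IsLiftSet.lift lifts s∈S
... | x , x∈A , x≡f₁s , x≡f₂s = x , gen (A⊆A′ x∈A) (≡[]-refl N x) , ≡[]⇒≋ x≡f₁s , ≡[]⇒≋ x≡f₂s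

module FiberProduct
  {NG NH : ℕ} {G H : Mat → Set} (G-subgroup : IsSubgroupGL₂ NG G) (H-subgroup : IsSubgroupGL₂ NH H)
  {sG sH : Mat → Mat}
  (secG : IsSection (gcd NG NH) NG (interImage (gcd NG NH) G H) G sG)
  (secH : IsSection (gcd NG NH) NH (interImage (gcd NG NH) G H) H sH)
  {SG SH Sd : Mat → Set}
  (genG : IsGeneratingSet NG (kernelMod (gcd NG NH) G) SG)
  (genH : IsGeneratingSet NH (kernelMod (gcd NG NH) H) SH)
  (genD : IsGeneratingSet (gcd NG NH) (interImage (gcd NG NH) G H) Sd)
  {AG AH Ad : Mat → Set}
  (liftG : IsLiftSet NG NH SG idMat constI AG)
  (liftH : IsLiftSet NH NG SH idMat constI AH)
  (liftD : IsLiftSet NG NH Sd sG sH Ad) where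

  private
    δ N : ℕ
    δ = gcd NG NH
    N = lcm NG NH
    A : Mat → Set
    A = AG ∪₃ AH ∪₃ Ad
    module G = IsSubgroupGL₂ G-subgroup
    module H = IsSubgroupGL₂ H-subgroup

  A⊆G : ∀ {x} → A x → G x
  A⊆G (inj₁ x∈AG)        = liftSet⊆ G-subgroup liftG (proj₁ ∘ IsGeneratingSet.sub genG) x∈AG
  A⊆G (inj₂ (inj₁ x∈AH)) = liftSet⊆ G-subgroup (IsLiftSet-swap liftH) (λ _ → G.one) x∈AH
  A⊆G (inj₂ (inj₂ x∈Ad)) =
    liftSet⊆ G-subgroup liftD (IsSection.lands secG ∘ IsGeneratingSet.sub genD) x∈Ad

  A⊆H : ∀ {x} → A x → H x
  A⊆H (inj₁ x∈AG)        = liftSet⊆ H-subgroup (IsLiftSet-swap liftG) (λ _ → H.one) x∈AG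
  A⊆H (inj₂ (inj₁ x∈AH)) = liftSet⊆ H-subgroup liftH (proj₁ ∘ IsGeneratingSet.sub genH) x∈AH
  A⊆H (inj₂ (inj₂ x∈Ad)) =
    liftSet⊆ H-subgroup (IsLiftSet-swap liftD) (IsSection.lands secH ∘ IsGeneratingSet.sub genD) x∈Ad

  Gen⊆G : ∀ {x} → Gen N A x → G x
  Gen⊆G = Gen⊆ (Subgroup.Gen-closed G-subgroup (m∣lcm[m,n] NG NH) A⊆G)

  Gen⊆H : ∀ {x} → Gen N A x → H x
  Gen⊆H = Gen⊆ (Subgroup.Gen-closed H-subgroup (n∣lcm[m,n] NG NH) A⊆H)

  open Realization (m∣lcm[m,n] NG NH) (n∣lcm[m,n] NG NH) ∣-refl A
  private
    module Swapped = Realization (n∣lcm[m,n] NG NH) (m∣lcm[m,n] NG NH) (∣-reflexive (lcm-comm NG NH)) A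

  Realized : Mat → Mat → Set
  Realized = Realizes NG NH (Gen N A)

  realizes-kernelG : ∀ {g} → G g → g ≋[ δ ] I₂ → Realized g I₂
  realizes-kernelG g∈G g≈1 =
    realizes-kernel (lift-realizes liftG inj₁) (IsGeneratingSet.gens genG (g∈G , ≋⇒≡[] g≈1))

  realizes-kernelH : ∀ {h} → H h → h ≋[ δ ] I₂ → Realized I₂ h
  realizes-kernelH h∈H h≈1 = Realizes-swap
    (Swapped.realizes-kernel (lift-realizes liftH (inj₂ ∘ inj₁)) (IsGeneratingSet.gens genH (h∈H , ≋⇒≡[] h≈1)))

  -- g = g₀ (g₀⁻¹ g) with g₀⁻¹ g ∈ G_δ, and likewise for h.
  realizes-adjust : ∀ {g₀ h₀ g h} → Realized g₀ h₀ → G g₀ → H h₀ → G g → H h →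
    g ≋[ δ ] g₀ → h ≋[ δ ] h₀ → Realized g h
  realizes-adjust {g₀} {h₀} {g} {h} r g₀∈G h₀∈H g∈G h∈H g≈g₀ h≈h₀
    with G.invCl g₀∈G | H.invCl h₀∈H
  ... | g₀′ , g₀′∈G , g₀g₀′≡1 | h₀′ , h₀′∈H , h₀h₀′≡1 =
    realizes-resp (realizes-⊗ (realizes-⊗ r (realizes-kernelG (G.mulCl g₀′∈G g∈G) g₀′g≈1))
                              (realizes-kernelH (H.mulCl h₀′∈H h∈H) h₀′h≈1))
                  g₀[g₀′g]I≈g h₀I[h₀′h]≈h
    where
    g₀′g≈1 : g₀′ ⊗ g ≋[ δ ] I₂
    g₀′g≈1 = ≋-trans (⊗-cong (≋-refl {x = g₀′}) g≈g₀)
                     (≋-weaken (gcd[m,n]∣m NG NH) (inverseʳ⇒inverseˡ {x = g₀} {g₀′} (≡[]⇒≋ g₀g₀′≡1)))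
    h₀′h≈1 : h₀′ ⊗ h ≋[ δ ] I₂
    h₀′h≈1 = ≋-trans (⊗-cong (≋-refl {x = h₀′}) h≈h₀)
                     (≋-weaken (gcd[m,n]∣n NG NH) (inverseʳ⇒inverseˡ {x = h₀} {h₀′} (≡[]⇒≋ h₀h₀′≡1)))
    g₀[g₀′g]I≈g : (g₀ ⊗ (g₀′ ⊗ g)) ⊗ I₂ ≋[ NG ] g
    g₀[g₀′g]I≈g = ≋-trans (≋-reflexive (⊗-identityʳ (g₀ ⊗ (g₀′ ⊗ g))))
                          (cancelˡ {x = g₀} {g₀′} g (≡[]⇒≋ g₀g₀′≡1))
    h₀I[h₀′h]≈h : (h₀ ⊗ I₂) ⊗ (h₀′ ⊗ h) ≋[ NH ] h
    h₀I[h₀′h]≈h = ≋-trans (⊗-cong (≋-reflexive (⊗-identityʳ h₀)) (≋-refl {x = h₀′ ⊗ h}))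
                          (cancelˡ {x = h₀} {h₀′} h (≡[]⇒≋ h₀h₀′≡1))

  RealizedOver : Mat → Set
  RealizedOver z = ∃₂ λ g h → G g × H h × g ≋[ δ ] z × h ≋[ δ ] z × Realized g h

  realizedOver-generator : ∀ {s} → Sd s → RealizedOver s
  realizedOver-generator {s} s∈Sd =
    sG s , sH s , IsSection.lands secG s∈K , IsSection.lands secH s∈K ,
    ≡[]⇒≋ (IsSection.section secG s∈K) , ≡[]⇒≋ (IsSection.section secH s∈K) ,
    lift-realizes liftD (inj₂ ∘ inj₂) s∈Sd
    where
    s∈K = IsGeneratingSet.sub genD s∈Sd

  realizedOver-⊗ : ∀ {x y} → RealizedOver x → RealizedOver y → RealizedOver (x ⊗ y)
  realizedOver-⊗ (g , h , g∈G , h∈H , g≈x , h≈x , r) (g′ , h′ , g′∈G , h′∈H , g′≈y , h′≈y , r′) =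
    g ⊗ g′ , h ⊗ h′ , G.mulCl g∈G g′∈G , H.mulCl h∈H h′∈H ,
    ⊗-cong g≈x g′≈y , ⊗-cong h≈x h′≈y , realizes-⊗ r r′

  realizedOver-inverse : ∀ {x y} → RealizedOver x → x ⊗ y ≋[ δ ] I₂ → RealizedOver y
  realizedOver-inverse (g , h , g∈G , h∈H , g≈x , h≈x , r) xy≈1
    with G.invCl g∈G | H.invCl h∈H
  ... | g′ , g′∈G , gg′≡1 | h′ , h′∈H , hh′≡1 =
    g′ , h′ , g′∈G , h′∈H ,
    inverseʳ-cong {g = g} g≈x xy≈1 (≋-weaken (gcd[m,n]∣m NG NH) (≡[]⇒≋ gg′≡1)) ,
    inverseʳ-cong {g = h} h≈x xy≈1 (≋-weaken (gcd[m,n]∣n NG NH) (≡[]⇒≋ hh′≡1)) ,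
    realizes-inverse r (≡[]⇒≋ gg′≡1) (≡[]⇒≋ hh′≡1)

  realizedOver-closed : IsGenClosed δ Sd RealizedOver
  realizedOver-closed = record
    { resp  = λ (g , h , g∈G , h∈H , g≈z , h≈z , r) z≈z′ →
                g , h , g∈G , h∈H , ≋-trans g≈z z≈z′ , ≋-trans h≈z z≈z′ , r
    ; base  = realizedOver-generator
    ; one   = I₂ , I₂ , G.one , H.one , ≋-refl , ≋-refl , realizes-I₂
    ; mulCl = realizedOver-⊗
    ; invCl = realizedOver-inverse
    }

  G∩H⊆Gen : ∀ {γ} → G γ → H γ → Gen N A γ
  G∩H⊆Gen {γ} γ∈G γ∈H
    with Gen⊆ realizedOver-closed
           (IsGeneratingSet.gens genD ((γ , γ∈G , ≡[]-refl δ γ) , (γ , γ∈H , ≡[]-refl δ γ)))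
  ... | g , h , g∈G , h∈H , g≈γ , h≈γ , r =
    realizes-diagonal (realizes-adjust r g∈G h∈H γ∈G γ∈H (≋-sym g≈γ) (≋-sym h≈γ))

mainTheorem11 : (NG NH : ℕ) → .{{_ : NonZero NG}} → .{{_ : NonZero NH}} →
    (G H : Mat → Set) → IsSubgroupGL₂ NG G → IsSubgroupGL₂ NH H →
    (sG sH : Mat → Mat) →
    IsSection (gcd NG NH) NG (interImage (gcd NG NH) G H) G sG →
    IsSection (gcd NG NH) NH (interImage (gcd NG NH) G H) H sH →
    (SG SH Sd : Mat → Set) →
    IsGeneratingSet NG (kernelMod (gcd NG NH) G) SG →
    IsGeneratingSet NH (kernelMod (gcd NG NH) H) SH →
    IsGeneratingSet (gcd NG NH) (interImage (gcd NG NH) G H) Sd →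
    (AG AH Ad : Mat → Set) →
    IsLiftSet NG NH SG idMat constI AG →
    IsLiftSet NH NG SH idMat constI AH →
    IsLiftSet NG NH Sd sG sH Ad →
    ∀ γ → Γ (Gen (lcm NG NH) (AG ∪₃ AH ∪₃ Ad)) γ ⇔ (Γ G γ × Γ H γ)
mainTheorem11 NG NH G H G-subgroup H-subgroup sG sH secG secH SG SH Sd genG genH genD AG AH Ad liftG liftH liftD γ =
  mk⇔ (λ (detγ≡1 , γ∈K) → (detγ≡1 , Gen⊆G γ∈K) , (detγ≡1 , Gen⊆H γ∈K))
      (λ ((detγ≡1 , γ∈G) , (_ , γ∈H)) → detγ≡1 , G∩H⊆Gen γ∈G γ∈H)
  where
  open FiberProduct G-subgroup H-subgroup secG secH genG genH genD liftG liftH liftD
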